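{- Let $k,n,m$ be positive integers and let $x$ be chosen randomly from $[k]^n$ according to the equal-slices measure. Then the probability that fewer than $m$ coordinates of $x$ are equal to $k$ is at most $mk/n$.
   Context: The equal-slices measure on $[k]^n$: choose, uniformly among all possibilities, a $k$-tuple $(a_1,\dots,a_k)$ of non-negative integers with sum $n$, then choose $x\in[k]^n$ uniformly among the sequences with $|\{i:x_i=j\}|=a_j$ for each $j$. -}

module Defs where

open import Data.Nat as ℕ using (ℕ; zero; suc; _<_; _<?_)
open import Data.Fin as Fin using (Fin; fromℕ)
import Data.Fin.Properties as FinP
open import Data.Vec as Vec using (Vec; []; _∷_; tabulate; toList)
import Data.Vec.Properties as VecP
open import Data.List as List using (List; []; _∷_; concatMap; map; filter; length; allFin; foldr)
open import Data.Integer using (+_)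
open import Data.Rational using (ℚ; 0ℚ; _+_; _/_; _*_)
open import Relation.Nullary using (Dec; yes; no)
open import Relation.Unary using (Pred; Decidable)
open import Relation.Binary.PropositionalEquality using (_≡_)

allSeqs : (k n : ℕ) → List (Vec (Fin k) n)
allSeqs k zero    = [] ∷ []
allSeqs k (suc n) = concatMap (λ i → map (i ∷_) (allSeqs k n)) (allFin k)

count : ∀ {k n} → Fin k → Vec (Fin k) n → ℕ
count j []      = 0
count j (y ∷ x) with j Fin.≟ y
... | yes _ = suc (count j x)
... | no  _ = count j x

slice : ∀ {k n} → Vec (Fin k) n → Vec ℕ k
slice x = tabulate (λ j → count j x)

sumV : ∀ {k} → Vec ℕ k → ℕ
sumV = Vec.foldr _ ℕ._+_ 0

-- All k-tuples (a_1,…,a_k) of non-negative integers with sum n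
-- (each a_j ≤ n necessarily, so we enumerate Vec (Fin (suc n)) k and filter).
allSlices : (k n : ℕ) → List (Vec ℕ k)
allSlices k n =
  filter (λ a → sumV a ℕ.≟ n) (map (Vec.map Fin.toℕ) (allSeqs (suc n) k))

-- 1/d as a rational (convention 1/0 = 0; only used for d > 0).
inv : ℕ → ℚ
inv zero    = 0ℚ
inv (suc d) = + 1 / suc d

-- Equal-slices probability of the single point x ∈ [k]^n:
-- (1 / #slices) * (1 / #{y ∈ [k]^n : slice y = slice x}).
equalSlicesWeight : (k n : ℕ) → Vec (Fin k) n → ℚ
equalSlicesWeight k n x =
  inv (length (allSlices k n))
    * inv (length (filter (λ y → VecP.≡-dec ℕ._≟_ (slice y) (slice x)) (allSeqs k n)))

sumℚ : List ℚ → ℚ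
sumℚ = foldr _+_ 0ℚ

equalSlicesProb : (k n : ℕ) {ℓ : _} {E : Pred (Vec (Fin k) n) ℓ} →
                  Decidable E → ℚ
equalSlicesProb k n E? = sumℚ (map (equalSlicesWeight k n) (filter E? (allSeqs k n)))

module Submission where

-- Under the equal-slices measure a sequence x has weight 1/(S·|[x]|), where S is the
-- number of slices and [x] the set of sequences with the same slice as x.  The event
-- depends only on the slice, so summing the weights class by class bounds its
-- probability by (number of slices with a_k < m)/S.  Slices are the weak compositions
-- of n into k parts, S = comp k n = C(n+k-1, k-1) of them; at most m·comp (k-1) n have
-- last part below m, and n·comp (k-1) n ≤ (k-1)·comp k n.

module Conditional {a} {A : Set a} (0# : A) where

  open import Relation.Nullary using (Dec; yes; no)

  infix 3 _if_

  _if_ : ∀ {p} {P : Set p} → A → Dec P → A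
  x if yes _ = x
  x if no  _ = 0#

module Counting where

  open import Defs using (allSeqs; count; slice; sumV; allSlices)
  open import Data.Nat using (ℕ; zero; suc; _+_; _*_; _∸_; _≤_; _<_; _≤?_; _<?_; _≟_; z≤n; s≤s; s≤s⁻¹)
  open import Data.Nat.Properties
  open import Data.Nat.ListAction using (sum)
  open import Data.Nat.ListAction.Properties using (sum-++)
  open import Algebra.Properties.CommutativeMonoid.Sum +-0-commutativeMonoid
    using (sum-syntax; sum-cong-≗; sum-replicate-zero; ∑-distrib-+)
  open import Data.Fin as Fin using (Fin; toℕ; fromℕ; fromℕ<)
  open import Data.Fin.Properties using (toℕ-injective; toℕ<n; toℕ-fromℕ<)
  open import Data.Vec as Vec using (Vec; []; _∷_; lookup; tabulate)
  open import Data.Vec.Properties using (tabulate-cong; tabulate-∘; lookup∘tabulate)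
  open import Data.List as List using (List; []; _∷_; _++_; map; filter; length; concatMap; allFin)
  open import Data.List.Properties using (map-∘; map-cong; map-++)
  open import Data.List.Membership.Propositional using (_∈_)
  open import Data.List.Membership.Propositional.Properties
    using (∈-map⁺; ∈-concat⁺′; ∈-filter⁺; ∈-allFin; ∈-length)
  open import Data.List.Relation.Unary.Any using (here)
  open import Relation.Nullary using (Dec; yes; no; ¬_)
  open import Relation.Unary using (Pred; Decidable)
  open import Relation.Binary.PropositionalEquality
  open import Function using (_∘_; id)
  open import Data.Empty using (⊥-elim)

  open Conditional 0

  ⟦_⟧ : ∀ {p} {P : Set p} → Dec P → ℕ
  ⟦ d ⟧ = 1 if d

  module _ {p q} {P : Set p} {Q : Set q} where

    if-cong : (P → Q) → (Q → P) → (d : Dec P) (e : Dec Q) → ∀ x → (x if d) ≡ (x if e)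
    if-cong f g (yes p) (yes q) x = refl
    if-cong f g (yes p) (no ¬q) x = ⊥-elim (¬q (f p))
    if-cong f g (no ¬p) (yes q) x = ⊥-elim (¬p (g q))
    if-cong f g (no ¬p) (no ¬q) x = refl

  if-yes : ∀ {p} {P : Set p} → P → (d : Dec P) → ∀ x → (x if d) ≡ x
  if-yes p (yes _) x = refl
  if-yes p (no ¬p) x = ⊥-elim (¬p p)

  if-no : ∀ {p} {P : Set p} → ¬ P → (d : Dec P) → ∀ x → (x if d) ≡ 0
  if-no ¬p (yes p) x = ⊥-elim (¬p p)
  if-no ¬p (no _)  x = refl

  ∑≤ : (ℕ → ℕ) → ℕ → ℕ
  ∑≤ f zero    = f zero
  ∑≤ f (suc n) = f (suc n) + ∑≤ f n

  ∑≤-cong : ∀ {f g} n → (∀ j → j ≤ n → f j ≡ g j) → ∑≤ f n ≡ ∑≤ g n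
  ∑≤-cong zero    e = e 0 z≤n
  ∑≤-cong (suc n) e = cong₂ _+_ (e (suc n) ≤-refl) (∑≤-cong n (λ j j≤n → e j (m≤n⇒m≤1+n j≤n)))

  ∑≤-mono-≤ : ∀ {f g} → (∀ j → f j ≤ g j) → ∀ n → ∑≤ f n ≤ ∑≤ g n
  ∑≤-mono-≤ f≤g zero    = f≤g zero
  ∑≤-mono-≤ f≤g (suc n) = +-mono-≤ (f≤g (suc n)) (∑≤-mono-≤ f≤g n)

  ∑≤-*ˡ : ∀ c f n → ∑≤ (λ j → c * f j) n ≡ c * ∑≤ f n
  ∑≤-*ˡ c f zero    = refl
  ∑≤-*ˡ c f (suc n) = trans (cong (c * f (suc n) +_) (∑≤-*ˡ c f n)) (sym (*-distribˡ-+ c (f (suc n)) _))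

  ∑≤-⟦⟧≤ : ∀ {p} {P : ℕ → Set p} (P? : ∀ j → Dec (P j)) n → ∑≤ (λ j → ⟦ P? j ⟧) n ≤ suc n
  ∑≤-⟦⟧≤ P? zero with P? zero
  ... | yes _ = ≤-refl
  ... | no  _ = z≤n
  ∑≤-⟦⟧≤ P? (suc n) with P? (suc n)
  ... | yes _ = s≤s (∑≤-⟦⟧≤ P? n)
  ... | no  _ = m≤n⇒m≤1+n (∑≤-⟦⟧≤ P? n)

  ∑≤-⟦<⟧≤ : ∀ M n → ∑≤ (λ j → ⟦ j <? M ⟧) n ≤ M
  ∑≤-⟦<⟧≤ M zero with 0 <? M
  ... | yes 0<M = 0<M
  ... | no  _   = z≤n
  ∑≤-⟦<⟧≤ M (suc n) with suc n <? M
  ... | yes n+1<M = ≤-<-trans (∑≤-⟦⟧≤ (_<? M) n) n+1<M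
  ... | no  _     = ∑≤-⟦<⟧≤ M n

  -- Numbers of weak compositions: comp k n of n into k parts, compLast< M k n of n
  -- into k + 1 parts whose last part is below M.
  comp : ℕ → ℕ → ℕ
  comp zero    zero    = 1
  comp zero    (suc n) = 0
  comp (suc k) n       = ∑≤ (comp k) n

  compLast< : ℕ → ℕ → ℕ → ℕ
  compLast< M zero    n = ⟦ n <? M ⟧
  compLast< M (suc k) n = ∑≤ (compLast< M k) n

  comp-1 : ∀ n → comp 1 n ≡ 1
  comp-1 zero    = refl
  comp-1 (suc n) = comp-1 n

  -- For k ≥ 1, comp k n = C(n+k-1, k-1); these are its ratio identities in n and in k.
  mutual
    comp-suc-n : ∀ k n → suc n * comp k (suc n) ≡ (n + k) * comp k n
    comp-suc-n zero    zero    = refl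
    comp-suc-n zero    (suc n) = trans (*-zeroʳ (suc (suc n))) (sym (*-zeroʳ (suc n + 0)))
    comp-suc-n (suc k) n = begin
      suc n * (comp k (suc n) + S)      ≡⟨ *-distribˡ-+ (suc n) (comp k (suc n)) S ⟩
      suc n * comp k (suc n) + suc n * S ≡⟨ cong (_+ suc n * S) (comp-suc-n k n) ⟩
      (n + k) * comp k n + suc n * S     ≡⟨ cong (_+ suc n * S) (comp-suc-k k n) ⟨
      k * S + suc n * S                  ≡⟨ *-distribʳ-+ S k (suc n) ⟨
      (k + suc n) * S                    ≡⟨ cong (_* S) (trans (+-comm k (suc n)) (sym (+-suc n k))) ⟩
      (n + suc k) * S                    ∎
      where
      open ≡-Reasoning
      S = comp (suc k) n

    comp-suc-k : ∀ k n → k * comp (suc k) n ≡ (n + k) * comp k n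
    comp-suc-k k zero    = refl
    comp-suc-k k (suc n) = begin
      k * (c + comp (suc k) n)          ≡⟨ *-distribˡ-+ k c _ ⟩
      k * c + k * comp (suc k) n        ≡⟨ cong (k * c +_) (comp-suc-k k n) ⟩
      k * c + (n + k) * comp k n        ≡⟨ cong (k * c +_) (comp-suc-n k n) ⟨
      k * c + suc n * c                 ≡⟨ *-distribʳ-+ c k (suc n) ⟨
      (k + suc n) * c                   ≡⟨ cong (_* c) (+-comm k (suc n)) ⟩
      (suc n + k) * c                   ∎
      where
      open ≡-Reasoning
      c = comp k (suc n)

  compLast<-≤ : ∀ M k n → compLast< M (suc k) n ≤ M * comp (suc k) n
  compLast<-≤ M zero    n = begin
    ∑≤ (λ j → ⟦ j <? M ⟧) n ≤⟨ ∑≤-⟦<⟧≤ M n ⟩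
    M                       ≡⟨ *-identityʳ M ⟨
    M * 1                   ≡⟨ cong (M *_) (comp-1 n) ⟨
    M * comp 1 n            ∎
    where open ≤-Reasoning
  compLast<-≤ M (suc k) n = begin
    ∑≤ (compLast< M (suc k)) n        ≤⟨ ∑≤-mono-≤ (compLast<-≤ M k) n ⟩
    ∑≤ (λ j → M * comp (suc k) j) n   ≡⟨ ∑≤-*ˡ M (comp (suc k)) n ⟩
    M * comp (suc (suc k)) n          ∎
    where open ≤-Reasoning

  compLast<-*-≤ : ∀ M k n → compLast< M k n * n ≤ M * suc k * comp (suc k) n
  compLast<-*-≤ M zero n with n <? M
  ... | yes n<M = begin
    1 * n            ≡⟨ *-identityˡ n ⟩
    n                ≤⟨ <⇒≤ n<M ⟩
    M                ≡⟨ *-identityʳ M ⟨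
    M * 1            ≡⟨ *-identityʳ (M * 1) ⟨
    M * 1 * 1        ≡⟨ cong (M * 1 *_) (comp-1 n) ⟨
    M * 1 * comp 1 n ∎
    where open ≤-Reasoning
  ... | no _ = z≤n
  compLast<-*-≤ M (suc k) n = begin
    compLast< M (suc k) n * n       ≤⟨ *-monoˡ-≤ n (compLast<-≤ M k n) ⟩
    M * c * n                       ≡⟨ *-assoc M c n ⟩
    M * (c * n)                     ≤⟨ *-monoʳ-≤ M c*n≤ ⟩
    M * (suc (suc k) * comp (suc (suc k)) n) ≡⟨ *-assoc M (suc (suc k)) _ ⟨
    M * suc (suc k) * comp (suc (suc k)) n  ∎
    where
    open ≤-Reasoning
    c = comp (suc k) n
    c*n≤ : c * n ≤ suc (suc k) * comp (suc (suc k)) n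
    c*n≤ = begin
      c * n                          ≡⟨ *-comm c n ⟩
      n * c                          ≤⟨ *-monoˡ-≤ c (m≤m+n n (suc k)) ⟩
      (n + suc k) * c                ≡⟨ comp-suc-k (suc k) n ⟨
      suc k * comp (suc (suc k)) n   ≤⟨ *-monoˡ-≤ _ (n≤1+n (suc k)) ⟩
      suc (suc k) * comp (suc (suc k)) n ∎

  module _ {a} {A : Set a} where

    sum-map-cong : ∀ {f g : A → ℕ} → (∀ x → f x ≡ g x) → ∀ xs → sum (map f xs) ≡ sum (map g xs)
    sum-map-cong f≗g xs = cong sum (map-cong f≗g xs)

    sum-map-if : ∀ {p} {P : Set p} (d : Dec P) (h : A → ℕ) xs →
                 sum (map (λ x → h x if d) xs) ≡ (sum (map h xs) if d)
    sum-map-if (yes _) h xs = refl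
    sum-map-if (no ¬p) h []       = refl
    sum-map-if (no ¬p) h (x ∷ xs) = sum-map-if (no ¬p) h xs

    sum-map-filter : ∀ {p} {P : Pred A p} (P? : Decidable P) (h : A → ℕ) xs →
                     sum (map h (filter P? xs)) ≡ sum (map (λ x → h x if P? x) xs)
    sum-map-filter P? h []       = refl
    sum-map-filter P? h (x ∷ xs) with P? x
    ... | yes _ = cong (h x +_) (sum-map-filter P? h xs)
    ... | no  _ = sum-map-filter P? h xs

    length≡sum : (xs : List A) → length xs ≡ sum (map (λ _ → 1) xs)
    length≡sum []       = refl
    length≡sum (x ∷ xs) = cong suc (length≡sum xs)

    length-filter≡sum : ∀ {p} {P : Pred A p} (P? : Decidable P) xs →
                        length (filter P? xs) ≡ sum (map (λ x → ⟦ P? x ⟧) xs)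
    length-filter≡sum P? xs = trans (length≡sum (filter P? xs)) (sum-map-filter P? (λ _ → 1) xs)

    module _ {b} {B : Set b} where

      sum-map-concatMap-tabulate : ∀ n (h : B → ℕ) (g : A → List B) (f : Fin n → A) →
        sum (map h (concatMap g (List.tabulate f))) ≡ ∑[ i < n ] sum (map h (g (f i)))
      sum-map-concatMap-tabulate zero    h g f = refl
      sum-map-concatMap-tabulate (suc n) h g f = begin
        sum (map h (g (f Fin.zero) ++ concatMap g (List.tabulate (f ∘ Fin.suc))))
          ≡⟨ cong sum (map-++ h (g (f Fin.zero)) _) ⟩
        sum (map h (g (f Fin.zero)) ++ map h (concatMap g (List.tabulate (f ∘ Fin.suc))))
          ≡⟨ sum-++ (map h (g (f Fin.zero))) _ ⟩
        sum (map h (g (f Fin.zero))) + sum (map h (concatMap g (List.tabulate (f ∘ Fin.suc))))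
          ≡⟨ cong (sum (map h (g (f Fin.zero))) +_) (sum-map-concatMap-tabulate n h g (f ∘ Fin.suc)) ⟩
        ∑[ i < suc n ] sum (map h (g (f i))) ∎
        where open ≡-Reasoning

  ∑-if-≤ : ∀ B n (R : ℕ → ℕ) → n < B → ∑[ i < B ] (R (n ∸ toℕ i) if toℕ i ≤? n) ≡ ∑≤ R n
  ∑-if-≤ (suc B) zero R _ = begin
    (R 0 if 0 ≤? 0) + ∑[ i < B ] (R 0 if suc (toℕ i) ≤? 0)
      ≡⟨ cong₂ _+_ (if-yes z≤n (0 ≤? 0) (R 0))
                   (sum-cong-≗ {B} (λ i → if-no (λ ()) (suc (toℕ i) ≤? 0) (R 0))) ⟩
    R 0 + ∑[ i < B ] 0 ≡⟨ cong (R 0 +_) (sum-replicate-zero B) ⟩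
    R 0 + 0            ≡⟨ +-identityʳ (R 0) ⟩
    R 0                ∎
    where open ≡-Reasoning
  ∑-if-≤ (suc B) (suc n) R (s≤s n<B) = cong₂ _+_ (if-yes z≤n (0 ≤? suc n) (R (suc n))) (begin
    ∑[ i < B ] (R (n ∸ toℕ i) if suc (toℕ i) ≤? suc n)
      ≡⟨ sum-cong-≗ {B} (λ i →
           if-cong s≤s⁻¹ s≤s (suc (toℕ i) ≤? suc n) (toℕ i ≤? n) (R (n ∸ toℕ i))) ⟩
    ∑[ i < B ] (R (n ∸ toℕ i) if toℕ i ≤? n) ≡⟨ ∑-if-≤ B n R n<B ⟩
    ∑≤ R n ∎)
    where open ≡-Reasoning

  ∑-if-≟ : ∀ B n c → n < B → ∑[ i < B ] (c if toℕ i ≟ n) ≡ c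
  ∑-if-≟ (suc B) zero c _ = begin
    (c if 0 ≟ 0) + ∑[ i < B ] (c if suc (toℕ i) ≟ 0)
      ≡⟨ cong₂ _+_ (if-yes refl (0 ≟ 0) c)
                   (sum-cong-≗ {B} (λ i → if-no (λ ()) (suc (toℕ i) ≟ 0) c)) ⟩
    c + ∑[ i < B ] 0 ≡⟨ cong (c +_) (sum-replicate-zero B) ⟩
    c + 0            ≡⟨ +-identityʳ c ⟩
    c                ∎
    where open ≡-Reasoning
  ∑-if-≟ (suc B) (suc n) c (s≤s n<B) = cong₂ _+_ (if-no (λ ()) (0 ≟ suc n) c) (begin
    ∑[ i < B ] (c if suc (toℕ i) ≟ suc n)
      ≡⟨ sum-cong-≗ {B} (λ i →
           if-cong suc-injective (cong suc) (suc (toℕ i) ≟ suc n) (toℕ i ≟ n) c) ⟩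
    ∑[ i < B ] (c if toℕ i ≟ n) ≡⟨ ∑-if-≟ B n c n<B ⟩
    c ∎)
    where open ≡-Reasoning

  module BoundedVectors (B : ℕ) where

    vecs : ∀ k → List (Vec ℕ k)
    vecs k = map (Vec.map toℕ) (allSeqs B k)

    sum-vecs-suc : ∀ k (h : Vec ℕ (suc k) → ℕ) →
      sum (map h (vecs (suc k))) ≡ ∑[ i < B ] sum (map (λ w → h (toℕ i ∷ w)) (vecs k))
    sum-vecs-suc k h = begin
      sum (map h (map (Vec.map toℕ) (concatMap g (allFin B))))
        ≡⟨ cong sum (map-∘ (concatMap g (allFin B))) ⟨
      sum (map (h ∘ Vec.map toℕ) (concatMap g (allFin B)))
        ≡⟨ sum-map-concatMap-tabulate B (h ∘ Vec.map toℕ) g id ⟩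
      ∑[ i < B ] sum (map (h ∘ Vec.map toℕ) (map (i ∷_) (allSeqs B k)))
        ≡⟨ sum-cong-≗ {B} (λ i →
             cong sum (trans (sym (map-∘ (allSeqs B k))) (map-∘ (allSeqs B k)))) ⟩
      ∑[ i < B ] sum (map (λ w → h (toℕ i ∷ w)) (vecs k)) ∎
      where
      open ≡-Reasoning
      g : Fin B → List (Vec (Fin B) (suc k))
      g i = map (i ∷_) (allSeqs B k)

    ∑sum≡ : ∀ {k} → (Vec ℕ k → ℕ) → ℕ → ℕ
    ∑sum≡ {k} g n = sum (map (λ v → g v if sumV v ≟ n) (vecs k))

    ∑sum≡-cong : ∀ {k} {f g : Vec ℕ k → ℕ} → (∀ v → f v ≡ g v) → ∀ n → ∑sum≡ f n ≡ ∑sum≡ g n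
    ∑sum≡-cong {k} f≗g n = sum-map-cong (λ v → cong (_if sumV v ≟ n) (f≗g v)) (vecs k)

    ∑sum≡-tail : ∀ {k} (g : Vec ℕ k → ℕ) n → n < B → ∑sum≡ (g ∘ Vec.tail) n ≡ ∑≤ (∑sum≡ g) n
    ∑sum≡-tail {k} g n n<B = begin
      sum (map (λ v → g (Vec.tail v) if sumV v ≟ n) (vecs (suc k)))
        ≡⟨ sum-vecs-suc k _ ⟩
      ∑[ i < B ] sum (map (λ w → g w if toℕ i + sumV w ≟ n) (vecs k))
        ≡⟨ sum-cong-≗ {B} (λ i → sum-map-cong (λ w → split (toℕ i) (sumV w) (g w)) (vecs k)) ⟩
      ∑[ i < B ] sum (map (λ w → (g w if sumV w ≟ n ∸ toℕ i) if toℕ i ≤? n) (vecs k))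
        ≡⟨ sum-cong-≗ {B} (λ i → sum-map-if (toℕ i ≤? n) _ (vecs k)) ⟩
      ∑[ i < B ] (∑sum≡ g (n ∸ toℕ i) if toℕ i ≤? n)
        ≡⟨ ∑-if-≤ B n (∑sum≡ g) n<B ⟩
      ∑≤ (∑sum≡ g) n ∎
      where
      open ≡-Reasoning
      split : ∀ j s x → (x if j + s ≟ n) ≡ ((x if s ≟ n ∸ j) if j ≤? n)
      split j s x with j ≤? n
      ... | no  j≰n = if-no (λ e → j≰n (subst (j ≤_) e (m≤m+n j s))) (j + s ≟ n) x
      ... | yes j≤n = if-cong (λ e → trans (sym (m+n∸m≡n j s)) (cong (_∸ j) e))
                              (λ e → trans (cong (j +_) e) (m+[n∸m]≡n j≤n)) (j + s ≟ n) (s ≟ n ∸ j) x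

    ∑sum≡-1 : ∀ k n → n < B → ∑sum≡ {k} (λ _ → 1) n ≡ comp k n
    ∑sum≡-1 zero    zero    _   = refl
    ∑sum≡-1 zero    (suc n) _   = refl
    ∑sum≡-1 (suc k) n       n<B = trans (∑sum≡-tail (λ _ → 1) n n<B)
      (∑≤-cong n (λ j j≤n → ∑sum≡-1 k j (≤-<-trans j≤n n<B)))

    ∑sum≡-last< : ∀ M k n → n < B →
                  ∑sum≡ {suc k} (λ v → ⟦ lookup v (fromℕ k) <? M ⟧) n ≡ compLast< M k n
    ∑sum≡-last< M zero n n<B = begin
      ∑sum≡ (λ v → ⟦ lookup v (fromℕ 0) <? M ⟧) n ≡⟨ sum-vecs-suc 0 _ ⟩
      ∑[ i < B ] (sum (map (λ w → ⟦ toℕ i <? M ⟧ if toℕ i + sumV w ≟ n) (vecs 0)))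
        ≡⟨ sum-cong-≗ {B} base ⟩
      ∑[ i < B ] (⟦ n <? M ⟧ if toℕ i ≟ n) ≡⟨ ∑-if-≟ B n ⟦ n <? M ⟧ n<B ⟩
      ⟦ n <? M ⟧ ∎
      where
      open ≡-Reasoning
      base : ∀ i → (⟦ toℕ i <? M ⟧ if toℕ i + 0 ≟ n) + 0 ≡ (⟦ n <? M ⟧ if toℕ i ≟ n)
      base i with toℕ i + 0 ≟ n | toℕ i ≟ n
      ... | yes _  | yes e    = trans (+-identityʳ _) (cong (λ j → ⟦ j <? M ⟧) e)
      ... | yes e  | no ≢n    = ⊥-elim (≢n (trans (sym (+-identityʳ _)) e))
      ... | no ≢n  | yes e    = ⊥-elim (≢n (trans (+-identityʳ _) e))
      ... | no _   | no _     = refl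
    ∑sum≡-last< M (suc k) n n<B = begin
      ∑sum≡ (λ v → ⟦ lookup v (fromℕ (suc k)) <? M ⟧) n
        ≡⟨ ∑sum≡-cong {suc (suc k)} (λ { (_ ∷ w) → refl }) n ⟩
      ∑sum≡ ((λ w → ⟦ lookup w (fromℕ k) <? M ⟧) ∘ Vec.tail) n
        ≡⟨ ∑sum≡-tail (λ w → ⟦ lookup w (fromℕ k) <? M ⟧) n n<B ⟩
      ∑≤ (∑sum≡ (λ w → ⟦ lookup w (fromℕ k) <? M ⟧)) n
        ≡⟨ ∑≤-cong n (λ j j≤n → ∑sum≡-last< M k j (≤-<-trans j≤n n<B)) ⟩
      compLast< M (suc k) n ∎
      where open ≡-Reasoning

  allSeqs-complete : ∀ k n (x : Vec (Fin k) n) → x ∈ allSeqs k n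
  allSeqs-complete k zero    []      = here refl
  allSeqs-complete k (suc n) (i ∷ x) =
    ∈-concat⁺′ (∈-map⁺ (i ∷_) (allSeqs-complete k n x))
               (∈-map⁺ (λ i → map (i ∷_) (allSeqs k n)) (∈-allFin i))

  count-≤ : ∀ {k n} (j : Fin k) (x : Vec (Fin k) n) → count j x ≤ n
  count-≤ j []      = z≤n
  count-≤ j (y ∷ x) with j Fin.≟ y
  ... | yes _ = s≤s (count-≤ j x)
  ... | no  _ = m≤n⇒m≤1+n (count-≤ j x)

  count-∷ : ∀ {k n} (j y : Fin k) (x : Vec (Fin k) n) → count j (y ∷ x) ≡ ⟦ j Fin.≟ y ⟧ + count j x
  count-∷ j y x with j Fin.≟ y
  ... | yes _ = refl
  ... | no  _ = refl

  lookup-slice : ∀ {k n} (x : Vec (Fin k) n) j → lookup (slice x) j ≡ count j x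
  lookup-slice x = lookup∘tabulate (λ j → count j x)

  sumV-tabulate : ∀ k (f : Fin k → ℕ) → sumV (tabulate f) ≡ ∑[ j < k ] f j
  sumV-tabulate zero    f = refl
  sumV-tabulate (suc k) f = cong (f Fin.zero +_) (sumV-tabulate k (f ∘ Fin.suc))

  ∑-⟦≟⟧ : ∀ k (y : Fin k) → ∑[ j < k ] ⟦ j Fin.≟ y ⟧ ≡ 1
  ∑-⟦≟⟧ k y = trans
    (sum-cong-≗ {k} (λ j → if-cong (cong toℕ) toℕ-injective (j Fin.≟ y) (toℕ j ≟ toℕ y) 1))
    (∑-if-≟ k (toℕ y) 1 (toℕ<n y))

  sumV-slice : ∀ {k n} (x : Vec (Fin k) n) → sumV (slice x) ≡ n
  sumV-slice {k} x = trans (sumV-tabulate k (λ j → count j x)) (∑-count x)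
    where
    ∑-count : ∀ {n} (x : Vec (Fin k) n) → ∑[ j < k ] count j x ≡ n
    ∑-count []      = sum-replicate-zero k
    ∑-count (y ∷ x) = begin
      ∑[ j < k ] count j (y ∷ x)
        ≡⟨ sum-cong-≗ {k} (λ j → count-∷ j y x) ⟩
      ∑[ j < k ] (⟦ j Fin.≟ y ⟧ + count j x)
        ≡⟨ ∑-distrib-+ (λ j → ⟦ j Fin.≟ y ⟧) (λ j → count j x) ⟩
      ∑[ j < k ] ⟦ j Fin.≟ y ⟧ + ∑[ j < k ] count j x
        ≡⟨ cong₂ _+_ (∑-⟦≟⟧ k y) (∑-count x) ⟩
      suc _ ∎
      where open ≡-Reasoning

  slice-∈-allSlices : ∀ {k n} (x : Vec (Fin k) n) → slice x ∈ allSlices k n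
  slice-∈-allSlices {k} {n} x =
    ∈-filter⁺ (λ a → sumV a ≟ n)
      (subst (_∈ _) toℕ-bounded (∈-map⁺ (Vec.map toℕ) (allSeqs-complete (suc n) k bounded)))
      (sumV-slice x)
    where
    bounded : Vec (Fin (suc n)) k
    bounded = tabulate (λ j → fromℕ< (s≤s (count-≤ j x)))
    toℕ-bounded : Vec.map toℕ bounded ≡ slice x
    toℕ-bounded = trans (sym (tabulate-∘ toℕ _)) (tabulate-cong (λ j → toℕ-fromℕ< (s≤s (count-≤ j x))))

  length-allSlices : ∀ k n → length (allSlices k n) ≡ comp k n
  length-allSlices k n = trans (length-filter≡sum (λ a → sumV a ≟ n) (vecs k)) (∑sum≡-1 k n (n<1+n n))
    where open BoundedVectors (suc n)

  length-allSlices-last< : ∀ M k n →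
    length (filter (λ a → lookup a (fromℕ k) <? M) (allSlices (suc k) n)) ≡ compLast< M k n
  length-allSlices-last< M k n = begin
    length (filter last<? (allSlices (suc k) n))
      ≡⟨ length-filter≡sum last<? (allSlices (suc k) n) ⟩
    sum (map (λ a → ⟦ last<? a ⟧) (filter (λ a → sumV a ≟ n) (vecs (suc k))))
      ≡⟨ sum-map-filter (λ a → sumV a ≟ n) (λ a → ⟦ last<? a ⟧) (vecs (suc k)) ⟩
    ∑sum≡ (λ a → ⟦ last<? a ⟧) n
      ≡⟨ ∑sum≡-last< M k n (n<1+n n) ⟩
    compLast< M k n ∎
    where
    open ≡-Reasoning
    open BoundedVectors (suc n)
    last<? : (a : Vec ℕ (suc k)) → Dec (lookup a (fromℕ k) < M)
    last<? a = lookup a (fromℕ k) <? M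

  length-allSlices>0 : ∀ k n → 0 < length (allSlices (suc k) n)
  length-allSlices>0 k n = ∈-length (slice-∈-allSlices {suc k} {n} (Vec.replicate n Fin.zero))

  length-allSlices-last<-≤ : ∀ M k n →
    length (filter (λ a → lookup a (fromℕ k) <? M) (allSlices (suc k) n)) * n
      ≤ M * suc k * length (allSlices (suc k) n)
  length-allSlices-last<-≤ M k n = subst₂ (λ a s → a * n ≤ M * suc k * s)
    (sym (length-allSlices-last< M k n)) (sym (length-allSlices (suc k) n)) (compLast<-*-≤ M k n)


module RationalSums where

  open import Defs using (sumℚ; inv)
  open import Data.Nat as ℕ using (ℕ; zero; suc)
  import Data.Nat.Properties as ℕ
  open import Data.Integer as ℤ using (+_)
  import Data.Integer.Properties as ℤ
  open import Data.Rational using (ℚ; 0ℚ; 1ℚ; _+_; _*_; _/_; _≤_; toℚᵘ)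
  open import Data.Rational.Properties
  import Data.Rational.Unnormalised as ℚᵘ
  import Data.Rational.Unnormalised.Properties as ℚᵘ
  open import Algebra.Bundles using (CommutativeMonoid)
  open import Algebra.Properties.CommutativeSemigroup
    (CommutativeMonoid.commutativeSemigroup +-0-commutativeMonoid) using (interchange)
  open import Data.List using (List; []; _∷_; map; filter; length)
  open import Data.List.Properties using (filter-none)
  open import Data.List.Relation.Unary.All.Properties using (all-filter)
  import Data.List.Relation.Unary.All as All
  open import Data.List.Membership.Propositional using (_∈_)
  open import Data.List.Relation.Unary.Any using (here; there)
  open import Data.List.Relation.Binary.Sublist.Propositional.Properties
    using (filter⁺; filter-⊆; length-mono-≤)
  open import Relation.Nullary using (Dec; yes; no)
  open import Relation.Unary using (Pred; Decidable)
  open import Relation.Binary using (DecidableEquality)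
  open import Relation.Binary.PropositionalEquality
  open import Data.Empty using (⊥-elim)

  open Conditional 0ℚ

  toℚᵘ-/ : ∀ a d → toℚᵘ (+ a / suc d) ℚᵘ.≃ ℚᵘ.mkℚᵘ (+ a) d
  toℚᵘ-/ a d = toℚᵘ-fromℚᵘ (ℚᵘ.mkℚᵘ (+ a) d)

  /-mono-≤ : ∀ a b c d → a ℕ.* suc d ℕ.≤ b ℕ.* suc c → + a / suc c ≤ + b / suc d
  /-mono-≤ a b c d ad≤bc = toℚᵘ-cancel-≤
    (ℚᵘ.≤-respˡ-≃ (ℚᵘ.≃-sym (toℚᵘ-/ a c)) (ℚᵘ.≤-respʳ-≃ (ℚᵘ.≃-sym (toℚᵘ-/ b d))
      (ℚᵘ.*≤* (subst₂ ℤ._≤_ (ℤ.pos-* a (suc d)) (ℤ.pos-* b (suc c)) (ℤ.+≤+ ad≤bc)))))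

  /-*-/ : ∀ a b c d → (+ a / suc c) * (+ b / suc d) ≡ + (a ℕ.* b) / (suc c ℕ.* suc d)
  /-*-/ a b c d = toℚᵘ-injective (begin
    toℚᵘ ((+ a / suc c) * (+ b / suc d))            ≈⟨ toℚᵘ-homo-* (+ a / suc c) (+ b / suc d) ⟩
    toℚᵘ (+ a / suc c) ℚᵘ.* toℚᵘ (+ b / suc d)      ≈⟨ ℚᵘ.*-cong (toℚᵘ-/ a c) (toℚᵘ-/ b d) ⟩
    ℚᵘ.mkℚᵘ (+ a ℤ.* + b) (d ℕ.+ c ℕ.* suc d)        ≡⟨ cong (λ z → ℚᵘ.mkℚᵘ z _) (ℤ.pos-* a b) ⟨
    ℚᵘ.mkℚᵘ (+ (a ℕ.* b)) (d ℕ.+ c ℕ.* suc d)        ≈⟨ toℚᵘ-/ (a ℕ.* b) (d ℕ.+ c ℕ.* suc d) ⟨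
    toℚᵘ (+ (a ℕ.* b) / (suc c ℕ.* suc d))          ∎)
    where open ℚᵘ.≃-Reasoning

  toℚ : ℕ → ℚ
  toℚ j = + j / 1

  toℚ-suc : ∀ j → toℚ (suc j) ≡ 1ℚ + toℚ j
  toℚ-suc j = toℚᵘ-injective (begin
    toℚᵘ (toℚ (suc j))                 ≈⟨ toℚᵘ-/ (suc j) 0 ⟩
    ℚᵘ.mkℚᵘ (+ suc j) 0                ≈⟨ ℚᵘ.*≡* cross-multiplied ⟩
    ℚᵘ.1ℚᵘ ℚᵘ.+ ℚᵘ.mkℚᵘ (+ j) 0         ≈⟨ ℚᵘ.+-congʳ ℚᵘ.1ℚᵘ (toℚᵘ-/ j 0) ⟨
    toℚᵘ 1ℚ ℚᵘ.+ toℚᵘ (toℚ j)          ≈⟨ toℚᵘ-homo-+ 1ℚ (toℚ j) ⟨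
    toℚᵘ (1ℚ + toℚ j)                  ∎)
    where
    open ℚᵘ.≃-Reasoning
    cross-multiplied : + suc j ℤ.* + 1 ≡ (+ 1 ℤ.* + 1 ℤ.+ + j ℤ.* + 1) ℤ.* + 1
    cross-multiplied = trans (ℤ.*-identityʳ (+ suc j))
      (sym (trans (ℤ.*-identityʳ _) (cong (λ z → + 1 ℤ.+ z) (ℤ.*-identityʳ (+ j)))))

  inv-nonNeg : ∀ c → 0ℚ ≤ inv c
  inv-nonNeg zero    = ≤-refl
  inv-nonNeg (suc d) = /-mono-≤ 0 1 0 d ℕ.z≤n

  inv-*-toℚ : ∀ s a → inv (suc s) * toℚ a ≡ + a / suc s
  inv-*-toℚ s a =
    trans (/-*-/ 1 a s 0) (cong₂ (λ z d → + z / suc d) (ℕ.*-identityˡ a) (ℕ.*-identityʳ s))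

  toℚ-*-inv≤1 : ∀ j c → j ℕ.≤ c → toℚ j * inv c ≤ 1ℚ
  toℚ-*-inv≤1 j zero    _   = subst (_≤ 1ℚ) (sym (*-zeroʳ (toℚ j))) (/-mono-≤ 0 1 0 0 ℕ.z≤n)
  toℚ-*-inv≤1 j (suc d) j≤c =
    subst (_≤ 1ℚ) (trans (sym (inv-*-toℚ d j)) (*-comm (inv (suc d)) (toℚ j)))
    (/-mono-≤ j 1 d 0 (subst₂ ℕ._≤_ (sym (ℕ.*-identityʳ j)) (sym (ℕ.*-identityˡ (suc d))) j≤c))

  inv-*-toℚ-≤ : ∀ S a b n → 0 ℕ.< S → a ℕ.* suc n ℕ.≤ b ℕ.* S → inv S * toℚ a ≤ + b / suc n
  inv-*-toℚ-≤ (suc s) a b n _ an≤bS =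
    subst (_≤ + b / suc n) (sym (inv-*-toℚ s a)) (/-mono-≤ a b s n an≤bS)

  module _ {a} {A : Set a} where

    sumℚ-mono-≤ : ∀ {f g : A → ℚ} → (∀ x → f x ≤ g x) → ∀ xs → sumℚ (map f xs) ≤ sumℚ (map g xs)
    sumℚ-mono-≤ f≤g []       = ≤-refl
    sumℚ-mono-≤ f≤g (x ∷ xs) = +-mono-≤ (f≤g x) (sumℚ-mono-≤ f≤g xs)

    sumℚ-nonNeg : ∀ {f : A → ℚ} → (∀ x → 0ℚ ≤ f x) → ∀ xs → 0ℚ ≤ sumℚ (map f xs)
    sumℚ-nonNeg f≥0 []       = ≤-refl
    sumℚ-nonNeg f≥0 (x ∷ xs) = +-mono-≤ (f≥0 x) (sumℚ-nonNeg f≥0 xs)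

    sumℚ-*ˡ : ∀ q (f : A → ℚ) xs → sumℚ (map (λ x → q * f x) xs) ≡ q * sumℚ (map f xs)
    sumℚ-*ˡ q f []       = sym (*-zeroʳ q)
    sumℚ-*ˡ q f (x ∷ xs) = trans (cong (_+_ (q * f x)) (sumℚ-*ˡ q f xs)) (sym (*-distribˡ-+ q (f x) _))

    sumℚ-+ : ∀ (f g : A → ℚ) xs →
             sumℚ (map (λ x → f x + g x) xs) ≡ sumℚ (map f xs) + sumℚ (map g xs)
    sumℚ-+ f g []       = sym (+-identityʳ 0ℚ)
    sumℚ-+ f g (x ∷ xs) = trans (cong (_+_ (f x + g x)) (sumℚ-+ f g xs)) (interchange (f x) (g x) _ _)

    sumℚ-zero : ∀ xs → sumℚ (map (λ (_ : A) → 0ℚ) xs) ≡ 0ℚ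
    sumℚ-zero []       = refl
    sumℚ-zero (x ∷ xs) = trans (+-identityˡ _) (sumℚ-zero xs)

    sumℚ-if : ∀ {p} {P : Pred A p} (P? : Decidable P) q xs →
              sumℚ (map (λ x → q if P? x) xs) ≡ toℚ (length (filter P? xs)) * q
    sumℚ-if P? q []       = sym (*-zeroˡ q)
    sumℚ-if P? q (x ∷ xs) with P? x
    ... | no  _ = trans (+-identityˡ _) (sumℚ-if P? q xs)
    ... | yes _ = begin
      q + sumℚ (map (λ x → q if P? x) xs) ≡⟨ cong (_+_ q) (sumℚ-if P? q xs) ⟩
      q + toℚ n * q                       ≡⟨ cong (_+ toℚ n * q) (*-identityˡ q) ⟨
      1ℚ * q + toℚ n * q                  ≡⟨ *-distribʳ-+ q 1ℚ (toℚ n) ⟨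
      (1ℚ + toℚ n) * q                    ≡⟨ cong (_* q) (toℚ-suc n) ⟨
      toℚ (suc n) * q                     ∎
      where
      open ≡-Reasoning
      n = length (filter P? xs)

  sumℚ-comm : ∀ {a b} {A : Set a} {B : Set b} (t : A → B → ℚ) xs ys →
    sumℚ (map (λ x → sumℚ (map (t x) ys)) xs) ≡ sumℚ (map (λ y → sumℚ (map (λ x → t x y) xs)) ys)
  sumℚ-comm t []       ys = sym (sumℚ-zero ys)
  sumℚ-comm t (x ∷ xs) ys = trans (cong (_+_ (sumℚ (map (t x) ys))) (sumℚ-comm t xs ys))
    (sym (sumℚ-+ (t x) (λ y → sumℚ (map (λ x → t x y) xs)) ys))

  if-nonNeg : ∀ {p} {P : Set p} {q} → 0ℚ ≤ q → (d : Dec P) → 0ℚ ≤ (q if d)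
  if-nonNeg q≥0 (yes _) = q≥0
  if-nonNeg q≥0 (no  _) = ≤-refl

  module _ {b} {B : Set b} (_≟_ : DecidableEquality B) where

    ≤-sumℚ-if-≟ : ∀ {f : B → ℚ} → (∀ b → 0ℚ ≤ f b) → ∀ {b bs} → b ∈ bs →
                  f b ≤ sumℚ (map (λ b′ → f b′ if b ≟ b′) bs)
    ≤-sumℚ-if-≟ {f} f≥0 {b} {_ ∷ bs} (here refl) with b ≟ b
    ... | no  b≢b = ⊥-elim (b≢b refl)
    ... | yes _   = begin
      f b        ≡⟨ +-identityʳ (f b) ⟨
      f b + 0ℚ
        ≤⟨ +-mono-≤ (≤-refl {f b}) (sumℚ-nonNeg (λ b′ → if-nonNeg (f≥0 b′) (b ≟ b′)) bs) ⟩
      f b + sumℚ (map (λ b′ → f b′ if b ≟ b′) bs) ∎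
      where open ≤-Reasoning
    ≤-sumℚ-if-≟ {f} f≥0 {b} {b′ ∷ bs} (there b∈bs) = begin
      f b        ≡⟨ +-identityˡ (f b) ⟨
      0ℚ + f b   ≤⟨ +-mono-≤ (if-nonNeg (f≥0 b′) (b ≟ b′)) (≤-sumℚ-if-≟ f≥0 b∈bs) ⟩
      (f b′ if b ≟ b′) + sumℚ (map (λ b′ → f b′ if b ≟ b′) bs) ∎
      where open ≤-Reasoning

  module Fibres {a b} {A : Set a} {B : Set b} (_≟_ : DecidableEquality B) (σ : A → B) (ys : List A) where

    fibreSize : B → ℕ
    fibreSize b = length (filter (λ y → σ y ≟ b) ys)

    sumℚ-inv-fibreSize-≤ : ∀ {p q} {P : Pred A p} {Q : Pred B q}
                           (P? : Decidable P) (Q? : Decidable Q) bs →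
      (∀ x → σ x ∈ bs) → (∀ x → P x → Q (σ x)) →
      sumℚ (map (λ x → inv (fibreSize (σ x))) (filter P? ys)) ≤ toℚ (length (filter Q? bs))
    sumℚ-inv-fibreSize-≤ {Q = Q} P? Q? bs σ∈bs P⇒Qσ = begin
      sumℚ (map (λ x → inv (fibreSize (σ x))) xs)
        ≤⟨ sumℚ-mono-≤ (λ x → ≤-sumℚ-if-≟ _≟_ (λ b → inv-nonNeg (fibreSize b)) (σ∈bs x)) xs ⟩
      sumℚ (map (λ x → sumℚ (map (λ b → inv (fibreSize b) if σ x ≟ b) bs)) xs)
        ≡⟨ sumℚ-comm (λ x b → inv (fibreSize b) if σ x ≟ b) xs bs ⟩
      sumℚ (map (λ b → sumℚ (map (λ x → inv (fibreSize b) if σ x ≟ b) xs)) bs)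
        ≤⟨ sumℚ-mono-≤ fibre-≤ bs ⟩
      sumℚ (map (λ b → 1ℚ if Q? b) bs)
        ≡⟨ sumℚ-if Q? 1ℚ bs ⟩
      toℚ (length (filter Q? bs)) * 1ℚ
        ≡⟨ *-identityʳ _ ⟩
      toℚ (length (filter Q? bs)) ∎
      where
      open ≤-Reasoning
      xs = filter P? ys
      fibre-≤ : ∀ b → sumℚ (map (λ x → inv (fibreSize b) if σ x ≟ b) xs) ≤ (1ℚ if Q? b)
      fibre-≤ b rewrite sumℚ-if (λ x → σ x ≟ b) (inv (fibreSize b)) xs with Q? b
      ... | yes _  = toℚ-*-inv≤1 _ (fibreSize b)
                       (length-mono-≤ (filter⁺ (λ x → σ x ≟ b) (λ y → σ y ≟ b)
                                               (λ { refl σx≡b → σx≡b }) (filter-⊆ P? ys)))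
      ... | no ¬Qb = ≤-reflexive (trans (cong (λ n → toℚ n * inv (fibreSize b)) (cong length no-x))
                                        (*-zeroˡ (inv (fibreSize b))))
        where
        no-x : filter (λ x → σ x ≟ b) xs ≡ []
        no-x = filter-none (λ x → σ x ≟ b)
          (All.map (λ {x} Px σx≡b → ¬Qb (subst Q σx≡b (P⇒Qσ x Px))) (all-filter P? ys))


open import Defs
open import Data.Nat using (ℕ; suc; _*_; _<_; _<?_)
open import Data.Fin using (fromℕ)
open import Data.Integer using (+_)
open import Data.Rational using (_≤_; _/_)
import Data.Nat as ℕ
import Data.Rational as ℚ
import Data.Rational.Properties as ℚ
open import Data.Vec using (Vec; lookup)
open import Data.Vec.Properties using (≡-dec)
open import Data.List using (map; filter; length)
open import Relation.Binary.PropositionalEquality using (subst; sym)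
open Counting using (lookup-slice; slice-∈-allSlices; length-allSlices>0; length-allSlices-last<-≤)
open RationalSums using (toℚ; inv-nonNeg; inv-*-toℚ-≤; sumℚ-*ˡ; module Fibres)

lemma3p4 : (k' n' m' : ℕ) →
    equalSlicesProb (suc k') (suc n') (λ x → count (fromℕ k') x <? suc m')
    ≤ (+ (suc m' * suc k')) / suc n'
lemma3p4 k' n' m' = begin
  equalSlicesProb K N E?
    ≡⟨ sumℚ-*ˡ (inv S) (λ x → inv (fibreSize (slice x))) (filter E? (allSeqs K N)) ⟩
  inv S ℚ.* sumℚ (map (λ x → inv (fibreSize (slice x))) (filter E? (allSeqs K N)))
    ≤⟨ ℚ.*-monoˡ-≤-nonNeg (inv S) {{ℚ.nonNegative (inv-nonNeg S)}}
         (sumℚ-inv-fibreSize-≤ E? last<? (allSlices K N) slice-∈-allSlices E⇒last<) ⟩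
  inv S ℚ.* toℚ (length (filter last<? (allSlices K N)))
    ≤⟨ inv-*-toℚ-≤ S (length (filter last<? (allSlices K N))) (M * K) n'
         (length-allSlices>0 k' N) (length-allSlices-last<-≤ M k' N) ⟩
  + (M * K) / N ∎
  where
  open ℚ.≤-Reasoning
  K = suc k'
  N = suc n'
  M = suc m'
  S = length (allSlices K N)
  open Fibres (≡-dec ℕ._≟_) slice (allSeqs K N)
  E? = λ x → count (fromℕ k') x <? M
  last<? = λ (a : Vec ℕ K) → lookup a (fromℕ k') <? M
  E⇒last< : ∀ x → count (fromℕ k') x < M → lookup (slice x) (fromℕ k') < M
  E⇒last< x = subst (_< M) (sym (lookup-slice x (fromℕ k')))
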